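{- Let $f,g$ be two covers with $f\sqsubseteq g$. The following are equivalent: (i) $f$ is isomorphic to $g$; (ii) $\deg f=\deg g$; (iii) ${\rm Hom}(g,f)$ contains an isomorphism. Moreover, if (i)–(iii) hold, then every cover in ${\rm Hom}(g,f)$ is an isomorphism.
   Context: Let $\mathbf C$ be a category and $\mathbf D$ a full subcategory of $\mathbf C$. For arrows $f,g$ of $\mathbf C$ with ${\rm cod}\,f={\rm cod}\,g$, ${\rm Hom}(g,f)$ denotes the collection of all arrows $h$ of $\mathbf C$ with $g=f\circ h$. Standing assumptions: (G1) every diagram $B\to A\leftarrow C$ in $\mathbf D$ has a pullback in $\mathbf C$. (G2) (I) pushouts exist in $\mathbf D$; (II) every arrow of $\mathbf D$ is epic; (III) every monic arrow of $\mathbf D$ is an isomorphism whose inverse is an arrow of $\mathbf D$. (G3) for every object $U$ of $\mathbf C$ there is a set $\Sigma(U)$ of arrows $i$ of $\mathbf C$ with ${\rm dom}\,i$ in $\mathbf D$ and ${\rm cod}\,i=U$ such that for every arrow $u$ of $\mathbf C$ with ${\rm dom}\,u$ in $\mathbf D$ and ${\rm cod}\,u=U$ there is exactly one $i\in\Sigma(U)$ with ${\rm Hom}(u,i)\neq\emptyset$. (G4) there is a function $\deg$ from the collection of arrows of $\mathbf C$ whose codomain lies in $\mathbf D$ to the positive integers such that (I) $\deg(g\circ f)=\deg g\cdot\deg f$ whenever $f,g,g\circ f$ all lie in this collection; (II) $\deg f=\sum_{i\in\Sigma({\rm dom}\,f)}\deg(f\circ i)$ for every such $f$; (III) if $B\xrightarrow{f}A\xleftarrow{g}C$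 is a diagram in $\mathbf D$ with pullback $B\xleftarrow{p}U\xrightarrow{q}C$, then $\deg f=\deg q$ and $\deg g=\deg p$. A cover is an arrow of $\mathbf D$. Write $f\sqsubseteq g$ if ${\rm cod}\,f={\rm cod}\,g$ and ${\rm Hom}(g,f)\neq\emptyset$. Two covers $f,g$ are isomorphic if $f\sqsubseteq g$ and $g\sqsubseteq f$. -}

module Defs where

open import Level using (Level; _⊔_; suc)
open import Data.Nat using (ℕ; zero; _+_; _*_; _≤_)
open import Data.Fin using (Fin)
import Data.Fin as Fin
open import Data.Product using (Σ; ∃; _×_; _,_; Σ-syntax; ∃-syntax)
open import Function.Bundles using (_↔_; Inverse)
open import Relation.Binary.PropositionalEquality using (_≡_)

sumFin : (n : ℕ) → (Fin n → ℕ) → ℕ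
sumFin zero    a = 0
sumFin (ℕ.suc n) a = a Fin.zero + sumFin n (λ k → a (Fin.suc k))

record Category (o ℓ : Level) : Set (Level.suc (o ⊔ ℓ)) where
  infixr 9 _∘_
  field
    Obj  : Set o
    Hom  : Obj → Obj → Set ℓ
    id   : ∀ {A} → Hom A A
    _∘_  : ∀ {A B C} → Hom B C → Hom A B → Hom A C
    assoc : ∀ {A B C D} (f : Hom A B) (g : Hom B C) (h : Hom C D) →
            (h ∘ g) ∘ f ≡ h ∘ (g ∘ f)
    identityˡ : ∀ {A B} (f : Hom A B) → id ∘ f ≡ f
    identityʳ : ∀ {A B} (f : Hom A B) → f ∘ id ≡ f

module CatNotions {o ℓ : Level} (𝐂 : Category o ℓ) where
  open Category 𝐂

  -- Hom(g,f) for f : B → A, g : C → A : arrows h : C → B with g = f ∘ h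
  HomOver : ∀ {A B C} → Hom C A → Hom B A → Set ℓ
  HomOver {A} {B} {C} g f = Σ[ h ∈ Hom C B ] (g ≡ f ∘ h)

  _⊑_ : ∀ {A B C} → Hom B A → Hom C A → Set ℓ
  f ⊑ g = HomOver g f

  IsIso : ∀ {A B} → Hom A B → Set ℓ
  IsIso {A} {B} f = Σ[ k ∈ Hom B A ] ((f ∘ k ≡ id) × (k ∘ f ≡ id))

  IsPullback : ∀ {A B C U} (f : Hom B A) (g : Hom C A) (p : Hom U B) (q : Hom U C) → Set (o ⊔ ℓ)
  IsPullback {A} {B} {C} {U} f g p q =
    (f ∘ p ≡ g ∘ q) ×
    (∀ {W} (p′ : Hom W B) (q′ : Hom W C) → f ∘ p′ ≡ g ∘ q′ →
       Σ[ h ∈ Hom W U ] ((p ∘ h ≡ p′) × (q ∘ h ≡ q′) ×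
         (∀ (h′ : Hom W U) → p ∘ h′ ≡ p′ → q ∘ h′ ≡ q′ → h′ ≡ h)))

-- The standing setting: a category C, a full subcategory D (given by a
-- predicate on objects; its arrows are all C-arrows between D-objects),
-- and the data/axioms (G1)–(G4).
record Setting (o ℓ : Level) : Set (Level.suc (o ⊔ ℓ)) where
  field
    𝐂   : Category o ℓ
  open Category 𝐂 public
  open CatNotions 𝐂 public
  field
    InD : Obj → Set ℓ

  IsPushoutD : ∀ {A B C P} (f : Hom A B) (g : Hom A C) (i : Hom B P) (j : Hom C P) → Set (o ⊔ ℓ)
  IsPushoutD {A} {B} {C} {P} f g i j =
    (i ∘ f ≡ j ∘ g) ×
    (∀ {W} → InD W → (i′ : Hom B W) (j′ : Hom C W) → i′ ∘ f ≡ j′ ∘ g →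
       Σ[ h ∈ Hom P W ] ((h ∘ i ≡ i′) × (h ∘ j ≡ j′) ×
         (∀ (h′ : Hom P W) → h′ ∘ i ≡ i′ → h′ ∘ j ≡ j′ → h′ ≡ h)))

  EpicD : ∀ {A B} → Hom A B → Set (o ⊔ ℓ)
  EpicD {A} {B} e = ∀ {W} → InD W → (h k : Hom B W) → h ∘ e ≡ k ∘ e → h ≡ k

  MonicD : ∀ {A B} → Hom A B → Set (o ⊔ ℓ)
  MonicD {A} {B} m = ∀ {W} → InD W → (h k : Hom W A) → m ∘ h ≡ m ∘ k → h ≡ k

  field
    G1 : ∀ {A B C} → InD A → InD B → InD C → (f : Hom B A) (g : Hom C A) →
         Σ[ U ∈ Obj ] Σ[ p ∈ Hom U B ] Σ[ q ∈ Hom U C ] IsPullback f g p q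
    G2-I : ∀ {A B C} → InD A → InD B → InD C → (f : Hom A B) (g : Hom A C) →
           Σ[ P ∈ Obj ] InD P × (Σ[ i ∈ Hom B P ] Σ[ j ∈ Hom C P ] IsPushoutD f g i j)
    G2-II : ∀ {A B} → InD A → InD B → (e : Hom A B) → EpicD e
    -- (G2)(III)  (the inverse is automatically in D, D being full)
    G2-III : ∀ {A B} → InD A → InD B → (m : Hom A B) → MonicD m → IsIso m
    -- (G3) Σ(U), given as a family of arrows indexed by a set Idx U
    Idx    : Obj → Set ℓ
    Σdom   : ∀ {U} → Idx U → Obj
    Σdom∈D : ∀ {U} (i : Idx U) → InD (Σdom i)
    Σarr   : ∀ {U} (i : Idx U) → Hom (Σdom i) U
    G3 : ∀ {U X} → InD X → (u : Hom X U) →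
         Σ[ i ∈ Idx U ] (HomOver u (Σarr i) ×
           (∀ (j : Idx U) → HomOver u (Σarr j) → j ≡ i))
    -- (G4) deg on arrows whose codomain lies in D (independent of the proof)
    deg     : ∀ {U A} → .(InD A) → Hom U A → ℕ
    deg-pos : ∀ {U A} .(a : InD A) (f : Hom U A) → 1 ≤ deg a f
    G4-I : ∀ {X A B} .(a : InD A) .(b : InD B) (f : Hom X A) (g : Hom A B) →
           deg b (g ∘ f) ≡ deg b g * deg a f
    G4-II : ∀ {U A} .(a : InD A) (f : Hom U A) →
            Σ[ n ∈ ℕ ] Σ[ e ∈ (Fin n ↔ Idx U) ]
              deg a f ≡ sumFin n (λ k → deg a (f ∘ Σarr (Inverse.to e k)))
    G4-III : ∀ {A B C U} (a : InD A) (b : InD B) (c : InD C)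
             (f : Hom B A) (g : Hom C A) (p : Hom U B) (q : Hom U C) →
             IsPullback f g p q → (deg a f ≡ deg c q) × (deg a g ≡ deg b p)

{-# OPTIONS --safe #-}
module Submission where

open import Defs
open import Level using (Level)
open import Data.Product using (_×_; Σ-syntax; proj₁; proj₂; _,_)
open import Relation.Binary.PropositionalEquality
open import Data.Nat using (ℕ; zero; suc; _*_; _≤_; z≤n; s≤s; >-nonZero)
open import Data.Nat.Properties using (+-mono-≤; ≤-antisym; m≤m*n; *-cancelˡ-≡; *-identityʳ)
open import Data.Fin using (Fin)
import Data.Fin as Fin
open import Function.Bundles using (_↔_; Inverse)

-- By multiplicativity of deg, an arrow h with g = f ∘ h has
-- deg g = deg f · deg h, so everything reduces to: a cover of degree 1 is an
-- isomorphism. For such a cover h : C → B, the kernel pair U of h has a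
-- projection of degree 1, so by (G4)(II) Σ(U) has a single element, i.e. U is
-- "connected". The two projections agree on the diagonal C → U, which
-- factors through that element of Σ(U) via an epic D-arrow, hence they agree
-- on every D-point of U. Thus h is monic in D, and (G2)(III) makes it an
-- isomorphism.

length≤sumFin : (n : ℕ) (a : Fin n → ℕ) → (∀ k → 1 ≤ a k) → n ≤ sumFin n a
length≤sumFin zero    a a≥1 = z≤n
length≤sumFin (suc n) a a≥1 =
  +-mono-≤ (a≥1 Fin.zero) (length≤sumFin n (λ k → a (Fin.suc k)) (λ k → a≥1 (Fin.suc k)))

Fin≤1-irrelevant : ∀ {n} → n ≤ 1 → (x y : Fin n) → x ≡ y
Fin≤1-irrelevant {suc zero}    _         Fin.zero Fin.zero = refl
Fin≤1-irrelevant {suc (suc n)} (s≤s ()) x y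

↔-irrelevant : ∀ {a b} {A : Set a} {B : Set b} → A ↔ B → (∀ (x y : A) → x ≡ y) → ∀ (x y : B) → x ≡ y
↔-irrelevant e irr x y = begin
  x                 ≡⟨ sym (Inverse.strictlyInverseˡ e x) ⟩
  to (from x)       ≡⟨ cong to (irr (from x) (from y)) ⟩
  to (from y)       ≡⟨ Inverse.strictlyInverseˡ e y ⟩
  y                 ∎
  where open ≡-Reasoning; open Inverse e using (to; from)

m*n≡m⇒n≡1 : ∀ m n → 1 ≤ m → m * n ≡ m → n ≡ 1
m*n≡m⇒n≡1 m n m≥1 eq = *-cancelˡ-≡ n 1 m {{>-nonZero m≥1}} (trans eq (sym (*-identityʳ m)))

m≡n*o⇒n≤m : ∀ m n o → 1 ≤ o → m ≡ n * o → n ≤ m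
m≡n*o⇒n≤m m n o o≥1 refl = m≤m*n n o {{>-nonZero o≥1}}

module Covers {o ℓ : Level} (S : Setting o ℓ) where
  open Setting S

  deg≡1⇒Σ-irrelevant : ∀ {U T} (t : InD T) (p : Hom U T) → deg t p ≡ 1 →
                       ∀ (i j : Idx U) → i ≡ j
  deg≡1⇒Σ-irrelevant t p deg≡1 with G4-II t p
  ... | n , e , deg≡sum = ↔-irrelevant e (Fin≤1-irrelevant n≤1)
    where
    n≤1 : n ≤ 1
    n≤1 = subst (n ≤_) (trans (sym deg≡sum) deg≡1)
            (length≤sumFin n _ (λ k → deg-pos t (p ∘ Σarr (Inverse.to e k))))

  agree-through-Σ : ∀ {U T X} → InD T → (x : InD X) (p q : Hom U T) (u : Hom X U) →
                    p ∘ u ≡ q ∘ u → p ∘ Σarr (proj₁ (G3 x u)) ≡ q ∘ Σarr (proj₁ (G3 x u))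
  agree-through-Σ t x p q u pu≡qu with G3 x u
  ... | i , (s , u≡is) , _ = G2-II x (Σdom∈D i) s t (p ∘ Σarr i) (q ∘ Σarr i) (begin
    (p ∘ Σarr i) ∘ s  ≡⟨ assoc s (Σarr i) p ⟩
    p ∘ (Σarr i ∘ s)  ≡⟨ cong (p ∘_) (sym u≡is) ⟩
    p ∘ u             ≡⟨ pu≡qu ⟩
    q ∘ u             ≡⟨ cong (q ∘_) u≡is ⟩
    q ∘ (Σarr i ∘ s)  ≡⟨ sym (assoc s (Σarr i) q) ⟩
    (q ∘ Σarr i) ∘ s  ∎)
    where open ≡-Reasoning

  agree-on-Σ⇒agree : ∀ {U T W} (i : Idx U) → (∀ (j : Idx U) → j ≡ i) → (p q : Hom U T) →
                     p ∘ Σarr i ≡ q ∘ Σarr i → InD W → (w : Hom W U) → p ∘ w ≡ q ∘ w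
  agree-on-Σ⇒agree i only-i p q pi≡qi wD w with G3 wD w
  ... | j , (s , w≡js) , _ rewrite only-i j = begin
    p ∘ w             ≡⟨ cong (p ∘_) w≡js ⟩
    p ∘ (Σarr i ∘ s)  ≡⟨ sym (assoc s (Σarr i) p) ⟩
    (p ∘ Σarr i) ∘ s  ≡⟨ cong (_∘ s) pi≡qi ⟩
    (q ∘ Σarr i) ∘ s  ≡⟨ assoc s (Σarr i) q ⟩
    q ∘ (Σarr i ∘ s)  ≡⟨ cong (q ∘_) (sym w≡js) ⟩
    q ∘ w             ∎
    where open ≡-Reasoning

  deg≡1⇒MonicD : ∀ {B C} (b : InD B) (c : InD C) (h : Hom C B) → deg b h ≡ 1 → MonicD h
  deg≡1⇒MonicD b c h deg≡1 wD u v hu≡hv with G1 b c c h h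
  ... | U , p , q , pullback@(_ , universal) = begin
    u      ≡⟨ sym (proj₁ (proj₂ mediator)) ⟩
    p ∘ w  ≡⟨ agree-on-Σ⇒agree i only-i p q diagonal-agrees wD w ⟩
    q ∘ w  ≡⟨ proj₁ (proj₂ (proj₂ mediator)) ⟩
    v      ∎
    where
    open ≡-Reasoning
    mediator = universal u v hu≡hv
    w = proj₁ mediator
    diagonal = universal id id refl
    i = proj₁ (G3 c (proj₁ diagonal))
    only-i : ∀ (j : Idx U) → j ≡ i
    only-i j = deg≡1⇒Σ-irrelevant c p
                 (trans (sym (proj₂ (G4-III b c c h h p q pullback))) deg≡1) j i
    diagonal-agrees : p ∘ Σarr i ≡ q ∘ Σarr i
    diagonal-agrees = agree-through-Σ c c p q (proj₁ diagonal)
                        (trans (proj₁ (proj₂ diagonal)) (sym (proj₁ (proj₂ (proj₂ diagonal)))))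

  deg≡1⇒IsIso : ∀ {B C} (b : InD B) (c : InD C) (h : Hom C B) → deg b h ≡ 1 → IsIso h
  deg≡1⇒IsIso b c h deg≡1 = G2-III c b h (deg≡1⇒MonicD b c h deg≡1)

  deg-over : ∀ {A B C} (a : InD A) (b : InD B) {f : Hom B A} {g : Hom C A} →
             (h : HomOver g f) → deg a g ≡ deg a f * deg b (proj₁ h)
  deg-over a b {f} (h , g≡fh) = trans (cong (deg a) g≡fh) (G4-I b a h f)

  ⊑⇒deg≤ : ∀ {A B C} (a : InD A) (b : InD B) {f : Hom B A} {g : Hom C A} →
           f ⊑ g → deg a f ≤ deg a g
  ⊑⇒deg≤ a b {f} {g} h = m≡n*o⇒n≤m (deg a g) (deg a f) _ (deg-pos b (proj₁ h)) (deg-over a b h)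

  deg≡⇒over-IsIso : ∀ {A B C} (a : InD A) (b : InD B) (c : InD C) {f : Hom B A} {g : Hom C A} →
                    deg a f ≡ deg a g → (h : HomOver g f) → IsIso (proj₁ h)
  deg≡⇒over-IsIso a b c {f} deg≡ h = deg≡1⇒IsIso b c (proj₁ h)
    (m*n≡m⇒n≡1 (deg a f) _ (deg-pos a f) (sym (trans deg≡ (deg-over a b h))))

  IsIso-over⇒⊒ : ∀ {A B C} {f : Hom B A} {g : Hom C A} →
                 ((h , _) : HomOver g f) → IsIso h → g ⊑ f
  IsIso-over⇒⊒ {f = f} {g} (h , g≡fh) (k , hk≡id , _) = k , (begin
    f            ≡⟨ sym (identityʳ f) ⟩
    f ∘ id       ≡⟨ cong (f ∘_) (sym hk≡id) ⟩
    f ∘ (h ∘ k)  ≡⟨ sym (assoc k h f) ⟩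
    (f ∘ h) ∘ k  ≡⟨ cong (_∘ k) (sym g≡fh) ⟩
    g ∘ k        ∎)
    where open ≡-Reasoning

corollary3p6 : {o ℓ : Level} (S : Setting o ℓ) →
    let open Setting S in
    ∀ {A B C} (a : InD A) (b : InD B) (c : InD C)
      (f : Hom B A) (g : Hom C A) → f ⊑ g →
      (((f ⊑ g × g ⊑ f) → deg a f ≡ deg a g)
        × (deg a f ≡ deg a g → Σ[ h ∈ HomOver g f ] IsIso (proj₁ h))
        × (Σ[ h ∈ HomOver g f ] IsIso (proj₁ h) → (f ⊑ g × g ⊑ f)))
      × ((f ⊑ g × g ⊑ f) → (h : HomOver g f) → IsIso (proj₁ h))
corollary3p6 S a b c f g f⊑g = (isomorphic⇒deg≡ , deg≡⇒iso , iso⇒isomorphic) , isomorphic⇒all-iso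
  where
  open Setting S
  open Covers S
  isomorphic⇒deg≡ : (f ⊑ g × g ⊑ f) → deg a f ≡ deg a g
  isomorphic⇒deg≡ (f⊑g , g⊑f) = ≤-antisym (⊑⇒deg≤ a b f⊑g) (⊑⇒deg≤ a c g⊑f)
  deg≡⇒iso : deg a f ≡ deg a g → Σ[ h ∈ HomOver g f ] IsIso (proj₁ h)
  deg≡⇒iso deg≡ = f⊑g , deg≡⇒over-IsIso a b c deg≡ f⊑g
  iso⇒isomorphic : Σ[ h ∈ HomOver g f ] IsIso (proj₁ h) → (f ⊑ g × g ⊑ f)
  iso⇒isomorphic (h , h-iso) = h , IsIso-over⇒⊒ h h-iso
  isomorphic⇒all-iso : (f ⊑ g × g ⊑ f) → (h : HomOver g f) → IsIso (proj₁ h)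
  isomorphic⇒all-iso isomorphic = deg≡⇒over-IsIso a b c (isomorphic⇒deg≡ isomorphic)
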